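{- Let $n\ge1$, let $c\in{\mathcal A}_n$ and let $k\in\{0,1\}$. Call an interior vertex $v$ of $L_n$ fixed (with respect to $c$ and $k$) if the two blue edges at $v$ in $c$ lie in distinct unit squares of parity $k$. Then for any two fixed vertices $v,w$, the following are equivalent: - $v$ and $w$ lie in the same connected component of the blue subgraph of $H_k(c)$; - $v$ and $w$ lie in the same connected component of the blue subgraph of $c$. The same equivalence holds with "blue" replaced by "green" in both conditions.
   Context: **The graph.** Work in the square grid $\mathbb{Z}^2$. Let $L_n$ be the graph whose interior vertices are the points $(x,y)$ with $1\le x,y\le n$, whose edges are all grid edges incident to an interior vertex, and whose endpoints are the $4n$ further degree-1 vertices incident to these edges. **Colorings.** Consider colorings of the edges of $L_n$ by blue and green such that every interior vertex is incident to exactly two blue and two green edges. The set ${\mathcal A}_n$ consists of those colorings that also satisfy the following boundary condition: - the edge at an endpoint $(x,y)$ with $x\in\{0,n+1\}$ is blue if and only if $x+y$ is odd; - the edge at an endpoint $(x,y)$ with $y\in\{0,n+1\}$ is blue if and only if $x+y$ is even. These colorings correspond to $n\times n$ alternating sign matrices. For an interior vertex, the two blue edges lie in distinct unit squares of a given parity exactly when the two green edges do. **Unit squares and parity.** The unit square with lower-left corner $(i,j)$ has parity $i+j \bmod 2$. Every grid edge lies in exactly one unit square of each parity. **The map $H_S$.** For a unit square $S$ that shares at least one edge with $L_n$, define $H_S$ on colorings as follows. - If all four edges of $S$ belong to $L_n$ and they alternate in color around $S$ (the two horizontal edges have one color and the two vertical edges the other), then $H_S$ leaves the coloring unchanged.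 - Otherwise, $H_S$ reverses the color of every edge of $S$ that belongs to $L_n$. **The map $H_k$.** $H_k$ is the composition of $H_S$ over all unit squares $S$ of parity $k$ sharing an edge with $L_n$. These squares have pairwise disjoint edge sets, so the maps $H_S$ commute and the order does not matter. -}

module Defs where

open import Data.Nat using (ℕ; zero; suc; _+_; _≤_; _≡ᵇ_; _≤ᵇ_; _%_)
open import Data.Bool using (Bool; true; false; _∧_; _∨_; not; if_then_else_)
open import Data.List using (List; []; _∷_; [_]; length; filterᵇ; foldr; concatMap; upTo)
open import Data.Bool.ListAction using (any)
open import Data.List.Membership.Propositional using (_∈_)
open import Data.Fin using (Fin; toℕ)
open import Data.Product using (Σ; _×_; _,_; proj₁; proj₂)
open import Data.Sum using (_⊎_)
open import Relation.Binary.PropositionalEquality using (_≡_; _≢_)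
open import Relation.Binary.Construct.Closure.ReflexiveTransitive using (Star)
open import Function.Bundles using (_⇔_)

Vertex : Set
Vertex = ℕ × ℕ

data Edge : Set where
  hor : ℕ → ℕ → Edge
  ver : ℕ → ℕ → Edge

ends : Edge → Vertex × Vertex
ends (hor x y) = (x , y) , (suc x , y)
ends (ver x y) = (x , y) , (x , suc y)

Joins : Edge → Vertex → Vertex → Set
Joins e u v = (proj₁ (ends e) ≡ u × proj₂ (ends e) ≡ v)
            ⊎ (proj₁ (ends e) ≡ v × proj₂ (ends e) ≡ u)

Incident : Vertex → Edge → Set
Incident v e = proj₁ (ends e) ≡ v ⊎ proj₂ (ends e) ≡ v

Interior : ℕ → Vertex → Set
Interior n (x , y) = (1 ≤ x × x ≤ n) × (1 ≤ y × y ≤ n)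

-- edges of L_n: the grid edges incident to an interior vertex
InL : ℕ → Edge → Set
InL n (hor x y) = x ≤ n × (1 ≤ y × y ≤ n)
InL n (ver x y) = (1 ≤ x × x ≤ n) × y ≤ n

inLᵇ : ℕ → Edge → Bool
inLᵇ n (hor x y) = (x ≤ᵇ n) ∧ ((1 ≤ᵇ y) ∧ (y ≤ᵇ n))
inLᵇ n (ver x y) = ((1 ≤ᵇ x) ∧ (x ≤ᵇ n)) ∧ (y ≤ᵇ n)

_==E_ : Edge → Edge → Bool
hor x y ==E hor x' y' = (x ≡ᵇ x') ∧ (y ≡ᵇ y')
ver x y ==E ver x' y' = (x ≡ᵇ x') ∧ (y ≡ᵇ y')
_ ==E _ = false

-- unit square given by its lower-left corner (i , j)
Square : Set
Square = ℕ × ℕ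

sqEdges : Square → List Edge
sqEdges (i , j) = hor i j ∷ hor i (suc j) ∷ ver i j ∷ ver (suc i) j ∷ []

parity : Square → ℕ
parity (i , j) = (i + j) % 2

data Color : Set where
  blue green : Color

flip : Color → Color
flip blue  = green
flip green = blue

_==C_ : Color → Color → Bool
blue  ==C blue  = true
green ==C green = true
_     ==C _     = false

Coloring : Set
Coloring = Edge → Color

-- the four edges at (x , y) (for an interior vertex these are exactly its incident edges)
edgesAt : Vertex → List Edge
edgesAt (x , y) = hor (x Data.Nat.∸ 1) y ∷ hor x y ∷ ver x (y Data.Nat.∸ 1) ∷ ver x y ∷ []

count : Coloring → Color → List Edge → ℕ
count c col es = length (filterᵇ (λ e → c e ==C col) es)

InA : ℕ → Coloring → Set
InA n c =
  (∀ v → Interior n v → count c blue (edgesAt v) ≡ 2 × count c green (edgesAt v) ≡ 2)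
  × (∀ y → 1 ≤ y → y ≤ n →
       -- endpoint (0 , y), edge hor 0 y ; endpoint (n+1 , y), edge hor n y
       ((c (hor 0 y) ≡ blue) ⇔ ((0 + y) % 2 ≡ 1))
     × ((c (hor n y) ≡ blue) ⇔ ((suc n + y) % 2 ≡ 1)))
  × (∀ x → 1 ≤ x → x ≤ n →
       -- endpoint (x , 0), edge ver x 0 ; endpoint (x , n+1), edge ver x n
       ((c (ver x 0) ≡ blue) ⇔ ((x + 0) % 2 ≡ 0))
     × ((c (ver x n) ≡ blue) ⇔ ((x + suc n) % 2 ≡ 0)))

_∈ᵇ_ : Edge → List Edge → Bool
e ∈ᵇ es = any (λ e' → e ==E e') es

alternating : ℕ → Coloring → Square → Bool
alternating n c (i , j) =
  (inLᵇ n (hor i j) ∧ inLᵇ n (hor i (suc j)) ∧ inLᵇ n (ver i j) ∧ inLᵇ n (ver (suc i) j))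
  ∧ (c (hor i j) ==C c (hor i (suc j)))
  ∧ (c (ver i j) ==C c (ver (suc i) j))
  ∧ not (c (hor i j) ==C c (ver i j))

H-sq : ℕ → Square → Coloring → Coloring
H-sq n S c e =
  if (e ∈ᵇ sqEdges S) ∧ inLᵇ n e ∧ not (alternating n c S)
  then flip (c e) else c e

sharesEdgeᵇ : ℕ → Square → Bool
sharesEdgeᵇ n S = any (inLᵇ n) (sqEdges S)

-- all unit squares of parity k sharing an edge with L_n
-- (any such square has its lower-left corner in {0..n}²)
squaresOf : ℕ → Fin 2 → List Square
squaresOf n k =
  concatMap (λ i → concatMap (λ j →
      if ((i + j) % 2 ≡ᵇ toℕ k) ∧ sharesEdgeᵇ n (i , j) then [ (i , j) ] else [])
    (upTo (suc n))) (upTo (suc n))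

H : ℕ → Fin 2 → Coloring → Coloring
H n k c = foldr (H-sq n) c (squaresOf n k)

Adj : ℕ → Coloring → Color → Vertex → Vertex → Set
Adj n c col u v = Σ Edge λ e → InL n e × c e ≡ col × Joins e u v

SameComponent : ℕ → Coloring → Color → Vertex → Vertex → Set
SameComponent n c col = Star (Adj n c col)

Fixed : ℕ → Coloring → Fin 2 → Vertex → Set
Fixed n c k v =
  Σ Edge λ e₁ → Σ Edge λ e₂ →
    Incident v e₁ × Incident v e₂ × e₁ ≢ e₂ × c e₁ ≡ blue × c e₂ ≡ blue
    × (∀ S₁ S₂ → parity S₁ ≡ toℕ k → parity S₂ ≡ toℕ k →
         e₁ ∈ sqEdges S₁ → e₂ ∈ sqEdges S₂ → S₁ ≢ S₂)

{-# OPTIONS --safe #-}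
module Submission where

-- Every edge of L_n is a side of exactly one unit square of parity k, and H_k acts on each such
-- square independently: it keeps an alternating square and flips the colours of any other one.
-- Call a vertex mixed if in every parity-k square at it the two sides meeting there have
-- different colours; at a vertex with two edges of each colour this is being fixed, and H_k
-- preserves it.  A monochromatic path between mixed vertices breaks into pieces, each inside a
-- single parity-k square between two mixed corners: where the path passes from one such square
-- into another, the vertex has edges of the path's colour in two parity-k squares and so is
-- mixed.  Inside one square, a check of all colourings of its sides shows that H_S keeps mixed
-- corners connected, provided a square with just one pair of opposite sides in L_n has them
-- coloured differently, which is what the boundary condition of 𝒜_n says.  Since H_k is an
-- involution and H_k(c) again has two edges of each colour at interior vertices, the same
-- argument run from H_k(c) gives the converse.

open import Data.Bool using (Bool; true; false; T; _∧_; _∨_; not; if_then_else_)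
open import Data.Bool.ListAction using (any; all)
open import Data.Bool.Properties using (T-∧; T-∨; T-≡) renaming (_≟_ to _≟ᵇ_)
open import Data.Empty using (⊥; ⊥-elim)
open import Data.Fin using (Fin; toℕ)
open import Data.List using (List; []; _∷_; [_]; map; cartesianProduct; length; filterᵇ; concatMap; foldr; upTo)
open import Data.List.Membership.Propositional using (_∈_; find; lose)
open import Data.List.Membership.Propositional.Properties
  using (∈-cartesianProduct⁺; ∈-map⁺; ∈-concatMap⁺; ∈-concatMap⁻; ∈-upTo⁺)
open import Data.List.Relation.Unary.All using (All; []; _∷_)
import Data.List.Relation.Unary.All as All
open import Data.List.Relation.Unary.All.Properties using (all⁺)
open import Data.List.Relation.Unary.AllPairs using ([]; _∷_)
open import Data.List.Relation.Unary.Any using (here; there; satisfied)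
import Data.List.Relation.Unary.Any as Any
open import Data.List.Relation.Unary.Any.Properties using (any⁻; any⁺)
open import Data.List.Relation.Unary.Unique.Propositional using (Unique)
open import Data.List.Relation.Unary.Unique.Propositional.Properties using (++⁺; upTo⁺)
open import Data.Maybe using (Maybe; just; nothing)
import Data.Maybe as Maybe
open import Data.Maybe.Properties using (map-∘; map-cong; map-id; just-injective)
open import Data.Nat using (ℕ; zero; suc; z≤n; s≤s; _+_; _∸_; _≤_; _%_; _≡ᵇ_; _≤ᵇ_)
open import Data.Nat.Properties
  using ( _≟_; _≤?_; 1+n≢n; +-suc; <⇒≤; ≤-antisym; ≤-pred; ≰⇒>
        ; ≡⇒≡ᵇ; ≡ᵇ⇒≡; ≤ᵇ⇒≤; ≤⇒≤ᵇ )
open import Data.Product using (∃; ∃₂; _×_; _,_; proj₁; proj₂)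
open import Data.Product.Function.NonDependent.Propositional using (_×-⇔_)
open import Data.Product.Properties using (≡-dec; ,-injectiveˡ; ,-injectiveʳ)
open import Data.Sum using (_⊎_; inj₁; inj₂)
open import Data.Unit using (tt)
open import Function.Base using (_∘_)
open import Function.Bundles using (_⇔_; mk⇔; Equivalence)
open import Function.Construct.Composition using (_⇔-∘_)
open import Relation.Binary.Construct.Closure.ReflexiveTransitive using (Star; ε; _◅_; _◅◅_)
import Relation.Binary.Construct.Closure.ReflexiveTransitive as Star
open import Relation.Binary.Definitions using (DecidableEquality)
open import Relation.Binary.PropositionalEquality
  using (_≡_; _≢_; refl; sym; trans; cong; cong₂; subst; module ≡-Reasoning)
open import Relation.Nullary using (¬_; Dec; yes; no)
open import Relation.Nullary.Decidable using (⌊_⌋; toWitness; toWitnessFalse; fromWitnessFalse)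

open import Defs

==C-sound : ∀ {a b} → T (a ==C b) → a ≡ b
==C-sound {blue}  {blue}  _ = refl
==C-sound {green} {green} _ = refl

==C-refl : ∀ a → T (a ==C a)
==C-refl blue  = tt
==C-refl green = tt

≢⇒not-==C : ∀ {a b} → a ≢ b → T (not (a ==C b))
≢⇒not-==C {blue}  {blue}  a≢b = a≢b refl
≢⇒not-==C {blue}  {green} _   = tt
≢⇒not-==C {green} {blue}  _   = tt
≢⇒not-==C {green} {green} a≢b = a≢b refl

not-==C⇒≢ : ∀ {a b} → T (not (a ==C b)) → a ≢ b
not-==C⇒≢ {blue}  () refl
not-==C⇒≢ {green} () refl

==E-sound : ∀ {e e'} → T (e ==E e') → e ≡ e'
==E-sound {hor x y} {hor x' y'} h with Equivalence.to (T-∧ {x ≡ᵇ x'}) h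
... | x≡ , y≡ = cong₂ hor (≡ᵇ⇒≡ x x' x≡) (≡ᵇ⇒≡ y y' y≡)
==E-sound {ver x y} {ver x' y'} h with Equivalence.to (T-∧ {x ≡ᵇ x'}) h
... | x≡ , y≡ = cong₂ ver (≡ᵇ⇒≡ x x' x≡) (≡ᵇ⇒≡ y y' y≡)

==E-refl : ∀ e → T (e ==E e)
==E-refl (hor x y) = Equivalence.from T-∧ (≡⇒≡ᵇ x x refl , ≡⇒≡ᵇ y y refl)
==E-refl (ver x y) = Equivalence.from T-∧ (≡⇒≡ᵇ x x refl , ≡⇒≡ᵇ y y refl)

∈ᵇ⇔∈ : ∀ e es → T (e ∈ᵇ es) ⇔ e ∈ es
∈ᵇ⇔∈ e es = mk⇔ (Any.map ==E-sound ∘ any⁻ (e ==E_) es)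
                (any⁺ (e ==E_) ∘ Any.map λ { refl → ==E-refl e })

colorCount : Color → List Color → ℕ
colorCount col cs = length (filterᵇ (_==C col) cs)

count≡colorCount : ∀ c col es → count c col es ≡ colorCount col (map c es)
count≡colorCount c col []       = refl
count≡colorCount c col (e ∷ es) with c e ==C col
... | true  = cong suc (count≡colorCount c col es)
... | false = count≡colorCount c col es

%2-suc-≢ : ∀ m → suc m % 2 ≢ m % 2
%2-suc-≢ zero          ()
%2-suc-≢ (suc zero)    ()
%2-suc-≢ (suc (suc m)) = %2-suc-≢ m

%2-cases : ∀ m (t : Fin 2) → m % 2 ≡ toℕ t ⊎ suc m % 2 ≡ toℕ t
%2-cases zero          Fin.zero           = inj₁ refl
%2-cases zero          (Fin.suc Fin.zero) = inj₂ refl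
%2-cases (suc zero)    Fin.zero           = inj₂ refl
%2-cases (suc zero)    (Fin.suc Fin.zero) = inj₁ refl
%2-cases (suc (suc m)) t                  = %2-cases m t

alternate-colors : ∀ {x y : Color} m m' (t : Fin 2) → m' % 2 ≡ suc m % 2 →
                   (x ≡ blue ⇔ m % 2 ≡ toℕ t) → (y ≡ blue ⇔ m' % 2 ≡ toℕ t) → x ≢ y
alternate-colors {blue} m m' t m'≡ x⇔ y⇔ refl =
  %2-suc-≢ m (trans (sym m'≡) (trans (Equivalence.to y⇔ refl) (sym (Equivalence.to x⇔ refl))))
alternate-colors {green} m m' t m'≡ x⇔ y⇔ refl with %2-cases m t
... | inj₁ m≡t with Equivalence.from x⇔ m≡t
...   | ()
alternate-colors {green} m m' t m'≡ x⇔ y⇔ refl | inj₂ sm≡t with Equivalence.from y⇔ (trans m'≡ sm≡t)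
...   | ()

≤-last : ∀ {m n} → m ≤ n → ¬ suc m ≤ n → m ≡ n
≤-last m≤n sm≰n = ≤-antisym m≤n (≤-pred (≰⇒> sm≰n))

T-≤ᵇ : ∀ {m n} → T (m ≤ᵇ n) ⇔ m ≤ n
T-≤ᵇ = mk⇔ (≤ᵇ⇒≤ _ _) ≤⇒≤ᵇ

concatMap-Unique : ∀ {A B : Set} (f : A → List B) (key : B → A) {xs} → Unique xs →
                   (∀ a → Unique (f a)) → (∀ a {b} → b ∈ f a → key b ≡ a) → Unique (concatMap f xs)
concatMap-Unique f key {[]}     []             _        _     = []
concatMap-Unique f key {a ∷ xs} (a∉xs ∷ uniq) unique-f keyed =
  ++⁺ (unique-f a) (concatMap-Unique f key uniq unique-f keyed) disjoint
  where
  disjoint : ∀ {b} → b ∈ f a × b ∈ concatMap f xs → ⊥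
  disjoint (b∈fa , b∈rest) with find (∈-concatMap⁻ f b∈rest)
  ... | a' , a'∈xs , b∈fa' = All.lookup a∉xs a'∈xs (trans (sym (keyed a b∈fa)) (keyed a' b∈fa'))

record Enumerable (A : Set) : Set where
  field
    elements : List A
    complete : ∀ a → a ∈ elements
open Enumerable {{...}}

-- The implicit argument is solved by evaluating `all f elements` to true while type checking.
by-exhaustion : {A : Set} {{_ : Enumerable A}} (f : A → Bool) → {T (all f elements)} → ∀ a → T (f a)
by-exhaustion f {h} a = All.lookup (all⁺ f elements h) (complete a)

instance
  Bool-enumerable : Enumerable Bool
  Bool-enumerable = record
    { elements = true ∷ false ∷ []
    ; complete = λ { true → here refl ; false → there (here refl) } }

  Color-enumerable : Enumerable Color
  Color-enumerable = record
    { elements = blue ∷ green ∷ []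
    ; complete = λ { blue → here refl ; green → there (here refl) } }

  Maybe-enumerable : {A : Set} {{_ : Enumerable A}} → Enumerable (Maybe A)
  Maybe-enumerable = record
    { elements = nothing ∷ map just elements
    ; complete = λ { nothing → here refl ; (just a) → there (∈-map⁺ just (complete a)) } }

  ×-enumerable : {A B : Set} {{_ : Enumerable A}} {{_ : Enumerable B}} → Enumerable (A × B)
  ×-enumerable = record
    { elements = cartesianProduct elements elements
    ; complete = λ (a , b) → ∈-cartesianProduct⁺ (complete a) (complete b) }

infixr 4 _⇒ᵇ_
infixl 4 _∙_

_⇒ᵇ_ : Bool → Bool → Bool
true  ⇒ᵇ y = y
false ⇒ᵇ _ = true

_∙_ : ∀ {x y} → T (x ⇒ᵇ y) → T x → T y
_∙_ {true} h _ = h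

⇒ᵇ-intro : ∀ {x y} → (T x → T y) → T (x ⇒ᵇ y)
⇒ᵇ-intro {true}  f = f tt
⇒ᵇ-intro {false} f = tt

T-not : ∀ {x} → T (not x) → ¬ T x
T-not {true} () _

data Side : Set where
  bottom top left right : Side

-- A corner is given by its offsets (east? , north?) from the lower-left corner of its square.
Corner : Set
Corner = Bool × Bool

-- The colours on the four sides of a unit square, with nothing for a side not in L_n.
record Patch : Set where
  constructor patch
  field
    onBottom onTop onLeft onRight : Maybe Color

colorOn : Patch → Side → Maybe Color
colorOn (patch b t l r) bottom = b
colorOn (patch b t l r) top    = t
colorOn (patch b t l r) left   = l
colorOn (patch b t l r) right  = r

instance
  Side-enumerable : Enumerable Side
  Side-enumerable = record
    { elements = bottom ∷ top ∷ left ∷ right ∷ []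
    ; complete = λ { bottom → here refl ; top → there (here refl)
                   ; left → there (there (here refl)) ; right → there (there (there (here refl))) } }

  Patch-enumerable : Enumerable Patch
  Patch-enumerable = record
    { elements = map uncurry-patch elements
    ; complete = λ (patch b t l r) → ∈-map⁺ uncurry-patch (complete (b , t , l , r)) }
    where
    uncurry-patch : Maybe Color × Maybe Color × Maybe Color × Maybe Color → Patch
    uncurry-patch (b , t , l , r) = patch b t l r

sides : List Side
sides = elements

corners : List Corner
corners = elements

startOf endOf : Side → Corner
startOf bottom = false , false
startOf top    = false , true
startOf left   = false , false
startOf right  = true  , false
endOf bottom = true  , false
endOf top    = true  , true
endOf left   = false , true
endOf right  = true  , true

horizontalAt verticalAt : Corner → Side
horizontalAt (_ , false) = bottom
horizontalAt (_ , true)  = top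
verticalAt (false , _) = left
verticalAt (true  , _) = right

_≟ᶜ_ : DecidableEquality Corner
_≟ᶜ_ = ≡-dec _≟ᵇ_ _≟ᵇ_

hasColor : Color → Maybe Color → Bool
hasColor col (just x) = x ==C col
hasColor col nothing  = false

differentColors : Maybe Color → Maybe Color → Bool
differentColors (just x) (just y) = not (x ==C y)
differentColors _        _        = false

present : Maybe Color → Bool
present (just _) = true
present nothing  = false

linksᵇ : Side → Corner → Corner → Bool
linksᵇ s p q =   (⌊ startOf s ≟ᶜ p ⌋ ∧ ⌊ endOf s ≟ᶜ q ⌋)
               ∨ (⌊ endOf s ≟ᶜ p ⌋ ∧ ⌊ startOf s ≟ᶜ q ⌋)

joinsᵇ : Color → Patch → Corner → Corner → Bool
joinsᵇ col P p q = any (λ s → hasColor col (colorOn P s) ∧ linksᵇ s p q) sides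

pathᵇ : ℕ → Color → Patch → Corner → Corner → Bool
pathᵇ zero    col P p q = ⌊ p ≟ᶜ q ⌋
pathᵇ (suc m) col P p q = ⌊ p ≟ᶜ q ⌋ ∨ any (λ r → joinsᵇ col P p r ∧ pathᵇ m col P r q) corners

-- Simple paths in a 4-cycle have at most three edges.
connectedᵇ : Color → Patch → Corner → Corner → Bool
connectedᵇ = pathᵇ 3

coloredAtᵇ : Color → Patch → Corner → Bool
coloredAtᵇ col P q =
  any (λ s → hasColor col (colorOn P s) ∧ (⌊ startOf s ≟ᶜ q ⌋ ∨ ⌊ endOf s ≟ᶜ q ⌋)) sides

mixedᵇ : Patch → Corner → Bool
mixedᵇ P p = differentColors (colorOn P (horizontalAt p)) (colorOn P (verticalAt p))

alternatingᵇ : Patch → Bool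
alternatingᵇ (patch (just b) (just t) (just l) (just r)) = (b ==C t) ∧ (l ==C r) ∧ not (b ==C l)
alternatingᵇ _ = false

flipUnless : Bool → Color → Color
flipUnless true  x = x
flipUnless false x = flip x

toggle : Patch → Patch
toggle P@(patch b t l r) = patch (f b) (f t) (f l) (f r)
  where f = Maybe.map (flipUnless (alternatingᵇ P))

-- A square with just one pair of opposite sides in L_n lies on the boundary, and that pair joins
-- consecutive endpoints, whose edges 𝒜_n colours differently.
compatibleᵇ : Patch → Bool
compatibleᵇ (patch b t l r) =
    (present b ∧ present t ∧ not (present l ∧ present r) ⇒ᵇ differentColors b t)
  ∧ (present l ∧ present r ∧ not (present b ∧ present t) ⇒ᵇ differentColors l r)

patch-ext : ∀ {P Q} → (∀ s → colorOn P s ≡ colorOn Q s) → P ≡ Q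
patch-ext {patch _ _ _ _} {patch _ _ _ _} eq with eq bottom | eq top | eq left | eq right
... | refl | refl | refl | refl = refl

colorOn-toggle : ∀ P s → colorOn (toggle P) s ≡ Maybe.map (flipUnless (alternatingᵇ P)) (colorOn P s)
colorOn-toggle (patch _ _ _ _) bottom = refl
colorOn-toggle (patch _ _ _ _) top    = refl
colorOn-toggle (patch _ _ _ _) left   = refl
colorOn-toggle (patch _ _ _ _) right  = refl

connected-extend : ∀ col P p q r → T (connectedᵇ col P p q) → T (joinsᵇ col P q r) →
                   T (connectedᵇ col P p r)
connected-extend col P p q r h₁ h₂ = by-exhaustion
  (λ (col , P , p , q , r) → connectedᵇ col P p q ⇒ᵇ joinsᵇ col P q r ⇒ᵇ connectedᵇ col P p r)
  (col , P , p , q , r) ∙ h₁ ∙ h₂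

toggle-preserves-connected : ∀ col P p q → T (mixedᵇ P p) → T (mixedᵇ P q) → T (compatibleᵇ P) →
                             T (connectedᵇ col P p q) → T (connectedᵇ col (toggle P) p q)
toggle-preserves-connected col P p q mp mq cP h = by-exhaustion
  (λ (col , P , p , q) → mixedᵇ P p ⇒ᵇ mixedᵇ P q ⇒ᵇ compatibleᵇ P
                           ⇒ᵇ connectedᵇ col P p q ⇒ᵇ connectedᵇ col (toggle P) p q)
  (col , P , p , q) ∙ mp ∙ mq ∙ cP ∙ h

toggle-preserves-mixed : ∀ P p → T (mixedᵇ P p) → T (mixedᵇ (toggle P) p)
toggle-preserves-mixed P p h = by-exhaustion (λ (P , p) → mixedᵇ P p ⇒ᵇ mixedᵇ (toggle P) p) (P , p) ∙ h

toggle-preserves-compatible : ∀ P → T (compatibleᵇ P) → T (compatibleᵇ (toggle P))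
toggle-preserves-compatible P h = by-exhaustion (λ P → compatibleᵇ P ⇒ᵇ compatibleᵇ (toggle P)) P ∙ h

toggle-preserves-alternating : ∀ P → alternatingᵇ (toggle P) ≡ alternatingᵇ P
toggle-preserves-alternating P =
  toWitness (by-exhaustion (λ P → ⌊ alternatingᵇ (toggle P) ≟ᵇ alternatingᵇ P ⌋) P)

alternating⇒mixed : ∀ P p → T (alternatingᵇ P) → T (mixedᵇ P p)
alternating⇒mixed P p h = by-exhaustion (λ (P , p) → alternatingᵇ P ⇒ᵇ mixedᵇ P p) (P , p) ∙ h

flipUnless-involutive : ∀ b x → flipUnless b (flipUnless b x) ≡ x
flipUnless-involutive true  x     = refl
flipUnless-involutive false blue  = refl
flipUnless-involutive false green = refl

toggle-involutive : ∀ P → toggle (toggle P) ≡ P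
toggle-involutive P = patch-ext λ s → begin
  colorOn (toggle (toggle P)) s                                   ≡⟨ colorOn-toggle (toggle P) s ⟩
  Maybe.map (flipUnless (alternatingᵇ (toggle P))) (colorOn (toggle P) s)
    ≡⟨ cong₂ (λ b → Maybe.map (flipUnless b)) (toggle-preserves-alternating P) (colorOn-toggle P s) ⟩
  Maybe.map (flipUnless alt) (Maybe.map (flipUnless alt) (colorOn P s)) ≡⟨ map-∘ (colorOn P s) ⟨
  Maybe.map (flipUnless alt ∘ flipUnless alt) (colorOn P s)
    ≡⟨ map-cong (flipUnless-involutive alt) (colorOn P s) ⟩
  Maybe.map (λ x → x) (colorOn P s)                               ≡⟨ map-id (colorOn P s) ⟩
  colorOn P s                                                     ∎
  where
  open ≡-Reasoning
  alt = alternatingᵇ P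

joins⇒connected : ∀ col P p q → T (joinsᵇ col P p q) → T (connectedᵇ col P p q)
joins⇒connected col P p q h = by-exhaustion
  (λ (col , P , p , q) → joinsᵇ col P p q ⇒ᵇ connectedᵇ col P p q) (col , P , p , q) ∙ h

joins⇒distinct : ∀ col P p q → T (joinsᵇ col P p q) → p ≢ q
joins⇒distinct col P p q h = toWitnessFalse (by-exhaustion
  (λ (col , P , p , q) → joinsᵇ col P p q ⇒ᵇ not ⌊ p ≟ᶜ q ⌋) (col , P , p , q) ∙ h)

connected⇒coloredAt : ∀ col P p q → p ≢ q → T (connectedᵇ col P p q) → T (coloredAtᵇ col P q)
connected⇒coloredAt col P p q p≢q h = by-exhaustion
  (λ (col , P , p , q) → not ⌊ p ≟ᶜ q ⌋ ⇒ᵇ connectedᵇ col P p q ⇒ᵇ coloredAtᵇ col P q)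
  (col , P , p , q)
  ∙ fromWitnessFalse {a? = p ≟ᶜ q} p≢q ∙ h

side-joins : ∀ col P s → T (hasColor col (colorOn P s)) →
             T (joinsᵇ col P (startOf s) (endOf s)) × T (joinsᵇ col P (endOf s) (startOf s))
side-joins col P s h = Equivalence.to (T-∧ {joinsᵇ col P (startOf s) (endOf s)}) (by-exhaustion
  (λ (col , P , s) → hasColor col (colorOn P s)
                       ⇒ᵇ joinsᵇ col P (startOf s) (endOf s) ∧ joinsᵇ col P (endOf s) (startOf s))
  (col , P , s) ∙ h)

data Direction : Set where
  west east south north : Direction

-- The two squares of parity k at a vertex are its north-east and south-west neighbours
-- (rising) or its north-west and south-east ones (falling).
data Diagonal : Set where
  rising falling : Diagonal

inNorthern : Diagonal → Direction → Bool
inNorthern rising  west  = false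
inNorthern rising  east  = true
inNorthern rising  south = false
inNorthern rising  north = true
inNorthern falling west  = true
inNorthern falling east  = false
inNorthern falling south = false
inNorthern falling north = true

pairIn : Diagonal → Bool → Direction × Direction
pairIn rising  true  = east , north
pairIn rising  false = west , south
pairIn falling true  = west , north
pairIn falling false = east , south

instance
  Diagonal-enumerable : Enumerable Diagonal
  Diagonal-enumerable = record
    { elements = rising ∷ falling ∷ []
    ; complete = λ { rising → here refl ; falling → there (here refl) } }

  Direction-enumerable : Enumerable Direction
  Direction-enumerable = record
    { elements = west ∷ east ∷ south ∷ north ∷ []
    ; complete = λ { west → here refl ; east → there (here refl)
                   ; south → there (there (here refl)) ; north → there (there (there (here refl))) } }

around : (Direction → Color) → List Color
around f = f west ∷ f east ∷ f south ∷ f north ∷ []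

around-cong : ∀ {f g} → (∀ d → f d ≡ g d) → around f ≡ around g
around-cong f≡g =
  cong₂ _∷_ (f≡g west) (cong₂ _∷_ (f≡g east) (cong₂ _∷_ (f≡g south) (cong₂ _∷_ (f≡g north) refl)))

mixedPairᵇ : Diagonal → (Direction → Color) → Bool → Bool
mixedPairᵇ δ f g = not (f (proj₁ (pairIn δ g)) ==C f (proj₂ (pairIn δ g)))

twoTwoᵇ : (Direction → Color) → Bool
twoTwoᵇ f = (colorCount blue (around f) ≡ᵇ 2) ∧ (colorCount green (around f) ≡ᵇ 2)

-- A function Direction → Color is checked through the tuple of its four values.
Colors⁴ : Set
Colors⁴ = Color × Color × Color × Color

tuple : (Direction → Color) → Colors⁴
tuple f = f west , f east , f south , f north

towards : Colors⁴ → Direction → Color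
towards (w , e , s , n) west  = w
towards (w , e , s , n) east  = e
towards (w , e , s , n) south = s
towards (w , e , s , n) north = n

towards-tuple : ∀ f d → towards (tuple f) d ≡ f d
towards-tuple f west  = refl
towards-tuple f east  = refl
towards-tuple f south = refl
towards-tuple f north = refl

mixedPair-tuple : ∀ δ f g → mixedPairᵇ δ (towards (tuple f)) g ≡ mixedPairᵇ δ f g
mixedPair-tuple δ f g = cong₂ (λ a b → not (a ==C b)) (towards-tuple f _) (towards-tuple f _)

split-pairs-mixed : ∀ col δ f d d' → colorCount col (around f) ≡ 2 → f d ≡ col → f d' ≡ col →
                    inNorthern δ d ≢ inNorthern δ d' → ∀ g → T (mixedPairᵇ δ f g)
split-pairs-mixed col δ f d d' two fd fd' apart g = subst T (mixedPair-tuple δ f g) (by-exhaustion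
  (λ (col , δ , cs , d , d' , g) →
     (colorCount col (around (towards cs)) ≡ᵇ 2) ⇒ᵇ (towards cs d ==C col) ⇒ᵇ (towards cs d' ==C col)
     ⇒ᵇ not ⌊ inNorthern δ d ≟ᵇ inNorthern δ d' ⌋ ⇒ᵇ mixedPairᵇ δ (towards cs) g)
  (col , δ , tuple f , d , d' , g)
  ∙ ≡⇒≡ᵇ _ 2 two ∙ has-col d fd ∙ has-col d' fd'
  ∙ fromWitnessFalse {a? = inNorthern δ d ≟ᵇ inNorthern δ d'} apart)
  where
  has-col : ∀ d → f d ≡ col → T (towards (tuple f) d ==C col)
  has-col d fd = subst (λ x → T (x ==C col)) (sym (trans (towards-tuple f d) fd)) (==C-refl col)

private
  recolor-pairs-if : ∀ δ f kN kS → T (twoTwoᵇ f) →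
                     (T kN → T (mixedPairᵇ δ f true)) → (T kS → T (mixedPairᵇ δ f false)) →
                     T (twoTwoᵇ (λ d → flipUnless (if inNorthern δ d then kN else kS) (f d)))
  recolor-pairs-if δ f kN kS two mN mS = by-exhaustion
    (λ (δ , cs , kN , kS) →
       twoTwoᵇ (towards cs) ⇒ᵇ (kN ⇒ᵇ mixedPairᵇ δ (towards cs) true)
       ⇒ᵇ (kS ⇒ᵇ mixedPairᵇ δ (towards cs) false) ⇒ᵇ twoTwoᵇ (λ d → flipUnless (if inNorthern δ d then kN else kS) (towards cs d)))
    (δ , tuple f , kN , kS)
    ∙ two ∙ ⇒ᵇ-intro (via-tuple true mN) ∙ ⇒ᵇ-intro (via-tuple false mS)
    where
    via-tuple : ∀ g {b} → (T b → T (mixedPairᵇ δ f g)) → T b → T (mixedPairᵇ δ (towards (tuple f)) g)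
    via-tuple g m h = subst T (sym (mixedPair-tuple δ f g)) (m h)

-- Split on δ so that keep (inNorthern δ d) computes to the form checked in recolor-pairs-if.
recolor-pairs-twoTwo : ∀ δ f (keep : Bool → Bool) → T (twoTwoᵇ f) →
                       (T (keep true) → T (mixedPairᵇ δ f true)) →
                       (T (keep false) → T (mixedPairᵇ δ f false)) →
                       T (twoTwoᵇ (λ d → flipUnless (keep (inNorthern δ d)) (f d)))
recolor-pairs-twoTwo rising  f keep = recolor-pairs-if rising  f (keep true) (keep false)
recolor-pairs-twoTwo falling f keep = recolor-pairs-if falling f (keep true) (keep false)

edgeOf : Square → Side → Edge
edgeOf (i , j) bottom = hor i j
edgeOf (i , j) top    = hor i (suc j)
edgeOf (i , j) left   = ver i j
edgeOf (i , j) right  = ver (suc i) j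

shift : Bool → ℕ → ℕ
shift false i = i
shift true  i = suc i

cornerOf : Square → Corner → Vertex
cornerOf (i , j) (a , b) = shift a i , shift b j

edgeOf-start : ∀ S s → proj₁ (ends (edgeOf S s)) ≡ cornerOf S (startOf s)
edgeOf-start S bottom = refl
edgeOf-start S top    = refl
edgeOf-start S left   = refl
edgeOf-start S right  = refl

edgeOf-end : ∀ S s → proj₂ (ends (edgeOf S s)) ≡ cornerOf S (endOf s)
edgeOf-end S bottom = refl
edgeOf-end S top    = refl
edgeOf-end S left   = refl
edgeOf-end S right  = refl

shift-injective : ∀ {a b} i → shift a i ≡ shift b i → a ≡ b
shift-injective {false} {false} i eq = refl
shift-injective {false} {true}  i eq = ⊥-elim (1+n≢n (sym eq))
shift-injective {true}  {false} i eq = ⊥-elim (1+n≢n eq)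
shift-injective {true}  {true}  i eq = refl

cornerOf-injective : ∀ S {p q} → cornerOf S p ≡ cornerOf S q → p ≡ q
cornerOf-injective (i , j) eq =
  cong₂ _,_ (shift-injective i (,-injectiveˡ eq)) (shift-injective j (,-injectiveʳ eq))

∈sqEdges⇒side : ∀ {e} S → e ∈ sqEdges S → ∃ λ s → e ≡ edgeOf S s
∈sqEdges⇒side S (here refl)                         = bottom , refl
∈sqEdges⇒side S (there (here refl))                 = top    , refl
∈sqEdges⇒side S (there (there (here refl)))         = left   , refl
∈sqEdges⇒side S (there (there (there (here refl)))) = right  , refl

edgeOf∈sqEdges : ∀ S s → edgeOf S s ∈ sqEdges S
edgeOf∈sqEdges S bottom = here refl
edgeOf∈sqEdges S top    = there (here refl)
edgeOf∈sqEdges S left   = there (there (here refl))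
edgeOf∈sqEdges S right  = there (there (there (here refl)))

_≟ˢ_ : DecidableEquality Square
_≟ˢ_ = ≡-dec _≟_ _≟_

Joins⇒Incident : ∀ {e u u'} → Joins e u u' → Incident u e
Joins⇒Incident (inj₁ (start≡ , _)) = inj₁ start≡
Joins⇒Incident (inj₂ (_ , end≡))   = inj₂ end≡

edgeTowards : Vertex → Direction → Edge
edgeTowards (x , y) west  = hor (x ∸ 1) y
edgeTowards (x , y) east  = hor x y
edgeTowards (x , y) south = ver x (y ∸ 1)
edgeTowards (x , y) north = ver x y

incident⇒direction : ∀ {x y e} → Incident (suc x , suc y) e →
                     ∃ λ d → e ≡ edgeTowards (suc x , suc y) d
incident⇒direction {e = hor _ _} (inj₁ refl) = east  , refl
incident⇒direction {e = hor _ _} (inj₂ refl) = west  , refl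
incident⇒direction {e = ver _ _} (inj₁ refl) = north , refl
incident⇒direction {e = ver _ _} (inj₂ refl) = south , refl

module _ (k : Fin 2) where

  Par : Square → Set
  Par S = parity S ≡ toℕ k

  Par-north-≢ : ∀ i j → Par (i , suc j) → ¬ Par (i , j)
  Par-north-≢ i j p q = %2-suc-≢ (i + j) (trans (trans (cong (_% 2) (sym (+-suc i j))) p) (sym q))

  Par-east-≢ : ∀ i j → Par (suc i , j) → ¬ Par (i , j)
  Par-east-≢ i j p q = %2-suc-≢ (i + j) (trans p (sym q))

  edgeOf-square-unique : ∀ S U s s' → edgeOf S s ≡ edgeOf U s' → Par S → Par U → S ≡ U
  edgeOf-square-unique (i , j) (i' , j') bottom bottom refl _  _  = refl
  edgeOf-square-unique (i , j) (i' , j') bottom top    refl pS pU = ⊥-elim (Par-north-≢ i' j' pS pU)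
  edgeOf-square-unique (i , j) (i' , j') bottom left   ()
  edgeOf-square-unique (i , j) (i' , j') bottom right  ()
  edgeOf-square-unique (i , j) (i' , j') top    bottom refl pS pU = ⊥-elim (Par-north-≢ i j pU pS)
  edgeOf-square-unique (i , j) (i' , j') top    top    refl _  _  = refl
  edgeOf-square-unique (i , j) (i' , j') top    left   ()
  edgeOf-square-unique (i , j) (i' , j') top    right  ()
  edgeOf-square-unique (i , j) (i' , j') left   bottom ()
  edgeOf-square-unique (i , j) (i' , j') left   top    ()
  edgeOf-square-unique (i , j) (i' , j') left   left   refl _  _  = refl
  edgeOf-square-unique (i , j) (i' , j') left   right  refl pS pU = ⊥-elim (Par-east-≢ i' j pS pU)
  edgeOf-square-unique (i , j) (i' , j') right  bottom ()
  edgeOf-square-unique (i , j) (i' , j') right  top    ()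
  edgeOf-square-unique (i , j) (i' , j') right  left   refl pS pU = ⊥-elim (Par-east-≢ i j pU pS)
  edgeOf-square-unique (i , j) (i' , j') right  right  refl _  _  = refl

  square-unique : ∀ {e} S U → e ∈ sqEdges S → e ∈ sqEdges U → Par S → Par U → S ≡ U
  square-unique S U e∈S e∈U with ∈sqEdges⇒side S e∈S | ∈sqEdges⇒side U e∈U
  ... | s , refl | s' , eq = edgeOf-square-unique S U s s' eq

  record Host (e : Edge) : Set where
    constructor host
    field
      square  : Square
      par     : Par square
      side    : Side
      is-side : e ≡ edgeOf square side

  Host-∈ : ∀ {e} (h : Host e) → e ∈ sqEdges (Host.square h)
  Host-∈ (host S _ s refl) = edgeOf∈sqEdges S s

  Host-unique : ∀ {e} (h h' : Host e) → Host.square h ≡ Host.square h'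
  Host-unique h h' = square-unique _ _ (Host-∈ h) (Host-∈ h') (Host.par h) (Host.par h')

  -- InL excludes hor x 0 and ver 0 y, whose square below or to the left has no corner in ℕ².
  hostOf : ∀ n e → InL n e → Host e
  hostOf n (hor x (suc y)) _ with %2-cases (x + y) k
  ... | inj₁ p = host (x , y) p top refl
  ... | inj₂ p = host (x , suc y) (trans (cong (_% 2) (+-suc x y)) p) bottom refl
  hostOf n (ver (suc x) y) _ with %2-cases (x + y) k
  ... | inj₁ p = host (x , y) p right refl
  ... | inj₂ p = host (suc x , y) p left refl

  OnDiagonal : Diagonal → Vertex → Set
  OnDiagonal rising  u = Par u
  OnDiagonal falling u = ¬ Par u

  diagonalAt : ∀ u → ∃ λ δ → OnDiagonal δ u
  diagonalAt u with parity u ≟ toℕ k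
  ... | yes p = rising  , p
  ... | no ¬p = falling , ¬p

  squareAt : Vertex → Diagonal → Bool → Square
  squareAt (x , y) rising  true  = x , y
  squareAt (x , y) rising  false = x ∸ 1 , y ∸ 1
  squareAt (x , y) falling true  = x ∸ 1 , y
  squareAt (x , y) falling false = x , y ∸ 1

  squareAt-Par : ∀ x y δ → OnDiagonal δ (suc x , suc y) → ∀ g → Par (squareAt (suc x , suc y) δ g)
  squareAt-Par x y rising  p true  = p
  squareAt-Par x y rising  p false = trans (cong (λ m → suc m % 2) (sym (+-suc x y))) p
  squareAt-Par x y falling ¬p true with %2-cases (x + suc y) k
  ... | inj₁ p = p
  ... | inj₂ p = ⊥-elim (¬p p)
  squareAt-Par x y falling ¬p false with %2-cases (suc (x + y)) k
  ... | inj₁ p = p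
  ... | inj₂ p = ⊥-elim (¬p (trans (cong (λ m → suc m % 2) (+-suc x y)) p))

  edgeTowards∈squareAt : ∀ x y δ d →
                         edgeTowards (suc x , suc y) d ∈ sqEdges (squareAt (suc x , suc y) δ (inNorthern δ d))
  edgeTowards∈squareAt x y rising  west  = there (here refl)
  edgeTowards∈squareAt x y rising  east  = here refl
  edgeTowards∈squareAt x y rising  south = there (there (there (here refl)))
  edgeTowards∈squareAt x y rising  north = there (there (here refl))
  edgeTowards∈squareAt x y falling west  = here refl
  edgeTowards∈squareAt x y falling east  = there (here refl)
  edgeTowards∈squareAt x y falling south = there (there (here refl))
  edgeTowards∈squareAt x y falling north = there (there (there (here refl)))

  module _ (n : ℕ) where

    inLᵇ⇔InL : ∀ e → T (inLᵇ n e) ⇔ InL n e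
    inLᵇ⇔InL (hor x y) = (T-≤ᵇ ×-⇔ ((T-≤ᵇ ×-⇔ T-≤ᵇ) ⇔-∘ T-∧)) ⇔-∘ T-∧
    inLᵇ⇔InL (ver x y) = (((T-≤ᵇ ×-⇔ T-≤ᵇ) ⇔-∘ T-∧) ×-⇔ T-≤ᵇ) ⇔-∘ T-∧

    colorIn : Coloring → Square → Side → Maybe Color
    colorIn c S s = if inLᵇ n (edgeOf S s) then just (c (edgeOf S s)) else nothing

    patchOf : Coloring → Square → Patch
    patchOf c S = patch (colorIn c S bottom) (colorIn c S top) (colorIn c S left) (colorIn c S right)

    colorOn-patchOf : ∀ c S s → colorOn (patchOf c S) s ≡ colorIn c S s
    colorOn-patchOf c S bottom = refl
    colorOn-patchOf c S top    = refl
    colorOn-patchOf c S left   = refl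
    colorOn-patchOf c S right  = refl

    colorIn-InL : ∀ c S s → InL n (edgeOf S s) → colorIn c S s ≡ just (c (edgeOf S s))
    colorIn-InL c S s inL with inLᵇ n (edgeOf S s) | Equivalence.from (inLᵇ⇔InL (edgeOf S s)) inL
    ... | true | _ = refl

    present-colorIn : ∀ c S s → present (colorIn c S s) ≡ inLᵇ n (edgeOf S s)
    present-colorIn c S s with inLᵇ n (edgeOf S s)
    ... | true  = refl
    ... | false = refl

    differentColors-colorIn : ∀ c S s s' → InL n (edgeOf S s) → InL n (edgeOf S s') →
                              c (edgeOf S s) ≢ c (edgeOf S s') →
                              T (differentColors (colorIn c S s) (colorIn c S s'))
    differentColors-colorIn c S s s' inL inL' c≢
      rewrite colorIn-InL c S s inL | colorIn-InL c S s' inL' = ≢⇒not-==C c≢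

    hasColor-patchOf⁺ : ∀ col c S s → InL n (edgeOf S s) → c (edgeOf S s) ≡ col →
                        T (hasColor col (colorOn (patchOf c S) s))
    hasColor-patchOf⁺ col c S s inL c≡col
      rewrite colorOn-patchOf c S s | colorIn-InL c S s inL | c≡col = ==C-refl col

    hasColor-patchOf⁻ : ∀ col c S s → T (hasColor col (colorOn (patchOf c S) s)) →
                        InL n (edgeOf S s) × c (edgeOf S s) ≡ col
    hasColor-patchOf⁻ col c S s h rewrite colorOn-patchOf c S s with inLᵇ n (edgeOf S s) in inL
    ... | true = Equivalence.to (inLᵇ⇔InL (edgeOf S s)) (subst T (sym inL) tt) , ==C-sound h

    mixed-patchOf⁺ : ∀ c S p → InL n (edgeOf S (horizontalAt p)) → InL n (edgeOf S (verticalAt p)) →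
                     c (edgeOf S (horizontalAt p)) ≢ c (edgeOf S (verticalAt p)) → T (mixedᵇ (patchOf c S) p)
    mixed-patchOf⁺ c S p inH inV c≢
      rewrite colorOn-patchOf c S (horizontalAt p) | colorOn-patchOf c S (verticalAt p) =
      differentColors-colorIn c S _ _ inH inV c≢

    mixed-patchOf⁻ : ∀ c S p → T (mixedᵇ (patchOf c S) p) →
                     c (edgeOf S (horizontalAt p)) ≢ c (edgeOf S (verticalAt p))
    mixed-patchOf⁻ c S p h rewrite colorOn-patchOf c S (horizontalAt p) | colorOn-patchOf c S (verticalAt p)
      with inLᵇ n (edgeOf S (horizontalAt p)) | inLᵇ n (edgeOf S (verticalAt p))
    ... | true | true = not-==C⇒≢ h

    patchOf-cong : ∀ {c c'} S → (∀ s → c' (edgeOf S s) ≡ c (edgeOf S s)) → patchOf c' S ≡ patchOf c S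
    patchOf-cong {c} {c'} S agree = patch-ext λ s → begin
      colorOn (patchOf c' S) s ≡⟨ colorOn-patchOf c' S s ⟩
      colorIn c' S s           ≡⟨ cong (λ x → if inLᵇ n (edgeOf S s) then just x else nothing) (agree s) ⟩
      colorIn c S s            ≡⟨ colorOn-patchOf c S s ⟨
      colorOn (patchOf c S) s  ∎
      where open ≡-Reasoning

    linksᵇ⇒Joins : ∀ S s p q → T (linksᵇ s p q) → Joins (edgeOf S s) (cornerOf S p) (cornerOf S q)
    linksᵇ⇒Joins S s p q h with Equivalence.to (T-∨ {⌊ startOf s ≟ᶜ p ⌋ ∧ ⌊ endOf s ≟ᶜ q ⌋}) h
    ... | inj₁ h' with Equivalence.to (T-∧ {⌊ startOf s ≟ᶜ p ⌋}) h'
    ...   | s≡p , e≡q = inj₁ ( trans (edgeOf-start S s) (cong (cornerOf S) (toWitness {a? = startOf s ≟ᶜ p} s≡p))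
                             , trans (edgeOf-end S s) (cong (cornerOf S) (toWitness {a? = endOf s ≟ᶜ q} e≡q)))
    linksᵇ⇒Joins S s p q h | inj₂ h' with Equivalence.to (T-∧ {⌊ endOf s ≟ᶜ p ⌋}) h'
    ...   | e≡p , s≡q = inj₂ ( trans (edgeOf-start S s) (cong (cornerOf S) (toWitness {a? = startOf s ≟ᶜ q} s≡q))
                             , trans (edgeOf-end S s) (cong (cornerOf S) (toWitness {a? = endOf s ≟ᶜ p} e≡p)))

    joins⇒Adj : ∀ col c S p q → T (joinsᵇ col (patchOf c S) p q) →
                Adj n c col (cornerOf S p) (cornerOf S q)
    joins⇒Adj col c S p q h with satisfied (any⁻ _ sides h)
    ... | s , h' with Equivalence.to T-∧ h'
    ...   | colored , links with hasColor-patchOf⁻ col c S s colored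
    ...     | inL , c≡col = edgeOf S s , inL , c≡col , linksᵇ⇒Joins S s p q links

    path⇒SameComponent : ∀ m col c S p q → T (pathᵇ m col (patchOf c S) p q) →
                         SameComponent n c col (cornerOf S p) (cornerOf S q)
    path⇒SameComponent zero col c S p q h rewrite toWitness {a? = p ≟ᶜ q} h = ε
    path⇒SameComponent (suc m) col c S p q h with Equivalence.to (T-∨ {⌊ p ≟ᶜ q ⌋}) h
    ... | inj₁ p≡q rewrite toWitness p≡q = ε
    ... | inj₂ h' with satisfied (any⁻ _ corners h')
    ...   | r , h'' with Equivalence.to T-∧ h''
    ...     | p~r , r~q = joins⇒Adj col c S p r p~r ◅ path⇒SameComponent m col c S r q r~q

    connected⇒SameComponent : ∀ col c S p q → T (connectedᵇ col (patchOf c S) p q) →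
                              SameComponent n c col (cornerOf S p) (cornerOf S q)
    connected⇒SameComponent = path⇒SameComponent 3

    coloredAt⇒side : ∀ col c S q → T (coloredAtᵇ col (patchOf c S) q) →
                     ∃ λ s → InL n (edgeOf S s) × c (edgeOf S s) ≡ col × Incident (cornerOf S q) (edgeOf S s)
    coloredAt⇒side col c S q h with satisfied (any⁻ _ sides h)
    ... | s , h' with Equivalence.to (T-∧ {hasColor col (colorOn (patchOf c S) s)}) h'
    ...   | colored , at with hasColor-patchOf⁻ col c S s colored
    ...     | inL , c≡col = s , inL , c≡col , incident (Equivalence.to (T-∨ {⌊ startOf s ≟ᶜ q ⌋}) at)
      where
      incident : (T ⌊ startOf s ≟ᶜ q ⌋ ⊎ T ⌊ endOf s ≟ᶜ q ⌋) → Incident (cornerOf S q) (edgeOf S s)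
      incident (inj₁ s≡q) = inj₁ (trans (edgeOf-start S s) (cong (cornerOf S) (toWitness s≡q)))
      incident (inj₂ e≡q) = inj₂ (trans (edgeOf-end S s) (cong (cornerOf S) (toWitness e≡q)))

    side-step : ∀ col c S s {u u'} → InL n (edgeOf S s) → c (edgeOf S s) ≡ col → Joins (edgeOf S s) u u' →
                ∃₂ λ q r → u ≡ cornerOf S q × u' ≡ cornerOf S r × T (joinsᵇ col (patchOf c S) q r)
    side-step col c S s inL c≡col (inj₁ (start≡ , end≡)) =
      startOf s , endOf s , trans (sym start≡) (edgeOf-start S s) , trans (sym end≡) (edgeOf-end S s) ,
      proj₁ (side-joins col (patchOf c S) s (hasColor-patchOf⁺ col c S s inL c≡col))
    side-step col c S s inL c≡col (inj₂ (start≡ , end≡)) =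
      endOf s , startOf s , trans (sym end≡) (edgeOf-end S s) , trans (sym start≡) (edgeOf-start S s) ,
      proj₂ (side-joins col (patchOf c S) s (hasColor-patchOf⁺ col c S s inL c≡col))

    interior-of-two-edges : ∀ {u e e'} → Incident u e → Incident u e' → InL n e → InL n e' → e ≢ e' →
                            Interior n u
    interior-of-two-edges {e = hor _ _} {hor _ _} (inj₁ refl) (inj₁ refl) _ _ e≢e' = ⊥-elim (e≢e' refl)
    interior-of-two-edges {e = hor _ _} {hor _ _} (inj₁ refl) (inj₂ refl) (x≤n , y) _ _ = (s≤s z≤n , x≤n) , y
    interior-of-two-edges {e = hor _ _} {hor _ _} (inj₂ refl) (inj₁ refl) (_ , y) (x≤n , _) _ = (s≤s z≤n , x≤n) , y
    interior-of-two-edges {e = hor _ _} {hor _ _} (inj₂ refl) (inj₂ refl) _ _ e≢e' = ⊥-elim (e≢e' refl)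
    interior-of-two-edges {e = hor _ _} {ver _ _} (inj₁ refl) (inj₁ refl) (_ , y) (x , _) _ = x , y
    interior-of-two-edges {e = hor _ _} {ver _ _} (inj₁ refl) (inj₂ refl) (_ , y) (x , _) _ = x , y
    interior-of-two-edges {e = hor _ _} {ver _ _} (inj₂ refl) (inj₁ refl) (_ , y) (x , _) _ = x , y
    interior-of-two-edges {e = hor _ _} {ver _ _} (inj₂ refl) (inj₂ refl) (_ , y) (x , _) _ = x , y
    interior-of-two-edges {e = ver _ _} {hor _ _} (inj₁ refl) (inj₁ refl) (x , _) (_ , y) _ = x , y
    interior-of-two-edges {e = ver _ _} {hor _ _} (inj₁ refl) (inj₂ refl) (x , _) (_ , y) _ = x , y
    interior-of-two-edges {e = ver _ _} {hor _ _} (inj₂ refl) (inj₁ refl) (x , _) (_ , y) _ = x , y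
    interior-of-two-edges {e = ver _ _} {hor _ _} (inj₂ refl) (inj₂ refl) (x , _) (_ , y) _ = x , y
    interior-of-two-edges {e = ver _ _} {ver _ _} (inj₁ refl) (inj₁ refl) _ _ e≢e' = ⊥-elim (e≢e' refl)
    interior-of-two-edges {e = ver _ _} {ver _ _} (inj₁ refl) (inj₂ refl) (x , y≤n) _ _ = x , (s≤s z≤n , y≤n)
    interior-of-two-edges {e = ver _ _} {ver _ _} (inj₂ refl) (inj₁ refl) (x , _) (_ , y≤n) _ = x , (s≤s z≤n , y≤n)
    interior-of-two-edges {e = ver _ _} {ver _ _} (inj₂ refl) (inj₂ refl) _ _ e≢e' = ⊥-elim (e≢e' refl)

    edgeTowards-InL : ∀ {x y} → Interior n (suc x , suc y) → ∀ d → InL n (edgeTowards (suc x , suc y) d)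
    edgeTowards-InL ((_ , x<n) , (_ , y<n)) west  = <⇒≤ x<n , (s≤s z≤n , y<n)
    edgeTowards-InL ((_ , x<n) , (_ , y<n)) east  = x<n , (s≤s z≤n , y<n)
    edgeTowards-InL ((_ , x<n) , (_ , y<n)) south = (s≤s z≤n , x<n) , <⇒≤ y<n
    edgeTowards-InL ((_ , x<n) , (_ , y<n)) north = (s≤s z≤n , x<n) , y<n

    Incident-InL : ∀ {u e} → Interior n u → Incident u e → InL n e
    Incident-InL {suc x , suc y} {e} int inc with incident⇒direction {x} {y} {e} inc
    ... | d , refl = edgeTowards-InL int d

    -- At a vertex with two edges of each colour, this is the paper's notion of a fixed vertex.
    MixedAt : Coloring → Vertex → Set
    MixedAt c u = ∀ S p → Par S → u ≡ cornerOf S p → T (mixedᵇ (patchOf c S) p)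

    mixed-pairs⇒MixedAt : ∀ c x y δ → Interior n (suc x , suc y) → OnDiagonal δ (suc x , suc y) →
                          (∀ g → T (mixedPairᵇ δ (c ∘ edgeTowards (suc x , suc y)) g)) → MixedAt c (suc x , suc y)
    mixed-pairs⇒MixedAt c x y rising  int _ mixed (_ , _) (false , false) _ refl =
      mixed-patchOf⁺ c (suc x , suc y) (false , false) (edgeTowards-InL int east) (edgeTowards-InL int north)
                     (not-==C⇒≢ (mixed true))
    mixed-pairs⇒MixedAt c x y rising  int _ mixed (_ , _) (true , true) _ refl =
      mixed-patchOf⁺ c (x , y) (true , true) (edgeTowards-InL int west) (edgeTowards-InL int south)
                     (not-==C⇒≢ (mixed false))
    mixed-pairs⇒MixedAt c x y falling int _ mixed (_ , _) (true , false) _ refl =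
      mixed-patchOf⁺ c (x , suc y) (true , false) (edgeTowards-InL int west) (edgeTowards-InL int north)
                     (not-==C⇒≢ (mixed true))
    mixed-pairs⇒MixedAt c x y falling int _ mixed (_ , _) (false , true) _ refl =
      mixed-patchOf⁺ c (suc x , y) (false , true) (edgeTowards-InL int east) (edgeTowards-InL int south)
                     (not-==C⇒≢ (mixed false))
    mixed-pairs⇒MixedAt c x y rising  _ p  _ (_ , _) (true , false)  p' refl = ⊥-elim (Par-east-≢ x (suc y) p p')
    mixed-pairs⇒MixedAt c x y rising  _ p  _ (_ , _) (false , true)  p' refl = ⊥-elim (Par-north-≢ (suc x) y p p')
    mixed-pairs⇒MixedAt c x y falling _ ¬p _ (_ , _) (false , false) p  refl = ⊥-elim (¬p p)
    mixed-pairs⇒MixedAt c x y falling _ ¬p _ (_ , _) (true , true)   p  refl =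
      ⊥-elim (¬p (trans (cong (λ m → suc m % 2) (+-suc x y)) p))

    two-hosts⇒MixedAt : ∀ col c u → Interior n u → count c col (edgesAt u) ≡ 2 →
                        ∀ {e e'} → Incident u e → Incident u e' → c e ≡ col → c e' ≡ col →
                        (h : Host e) (h' : Host e') → Host.square h ≢ Host.square h' → MixedAt c u
    two-hosts⇒MixedAt col c (suc x , suc y) int two {e} {e'} inc inc' ce ce' h h' apart
      with incident⇒direction {x} {y} {e} inc | incident⇒direction {x} {y} {e'} inc' | diagonalAt (suc x , suc y)
    ... | d , refl | d' , refl | δ , onδ = mixed-pairs⇒MixedAt c x y δ int onδ
          (split-pairs-mixed col δ (c ∘ edgeTowards u) d d'
             (trans (sym (count≡colorCount c col (edgesAt u))) two) ce ce' northern-apart)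
      where
      u = suc x , suc y
      hosted-at : ∀ {d} (h : Host (edgeTowards u d)) → Host.square h ≡ squareAt u δ (inNorthern δ d)
      hosted-at {d} h =
        square-unique _ _ (Host-∈ h) (edgeTowards∈squareAt x y δ d) (Host.par h) (squareAt-Par x y δ onδ _)
      northern-apart : inNorthern δ d ≢ inNorthern δ d'
      northern-apart eq = apart (trans (hosted-at h) (trans (cong (squareAt u δ) eq) (sym (hosted-at h'))))

    TwoTwo : Coloring → Set
    TwoTwo c = ∀ v → Interior n v → count c blue (edgesAt v) ≡ 2 × count c green (edgesAt v) ≡ 2

    TwoTwo-count : ∀ {c} → TwoTwo c → ∀ col v → Interior n v → count c col (edgesAt v) ≡ 2
    TwoTwo-count two-two blue  v int = proj₁ (two-two v int)
    TwoTwo-count two-two green v int = proj₂ (two-two v int)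

    Fixed⇒MixedAt : ∀ {c u} → TwoTwo c → Interior n u → Fixed n c k u → MixedAt c u
    Fixed⇒MixedAt {c} {u} two-two int (e₁ , e₂ , inc₁ , inc₂ , _ , c₁ , c₂ , apart) =
      two-hosts⇒MixedAt blue c u int (TwoTwo-count {c} two-two blue u int) inc₁ inc₂ c₁ c₂ h₁ h₂
        (apart _ _ (Host.par h₁) (Host.par h₂) (Host-∈ h₁) (Host-∈ h₂))
      where
      h₁ = hostOf n e₁ (Incident-InL int inc₁)
      h₂ = hostOf n e₂ (Incident-InL int inc₂)

    record SquareStep (c : Coloring) (col : Color) (a b : Vertex) : Set where
      constructor squareStep
      field
        square     : Square
        par        : Par square
        from to    : Corner
        at-from    : a ≡ cornerOf square from
        at-to      : b ≡ cornerOf square to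
        mixed-from : T (mixedᵇ (patchOf c square) from)
        mixed-to   : T (mixedᵇ (patchOf c square) to)
        linked     : T (connectedᵇ col (patchOf c square) from to)

    record WithinSquare (c : Coloring) (col : Color) (a u : Vertex) : Set where
      constructor within
      field
        square   : Square
        par      : Par square
        from to  : Corner
        at-from  : a ≡ cornerOf square from
        at-to    : u ≡ cornerOf square to
        distinct : from ≢ to
        linked   : T (connectedᵇ col (patchOf c square) from to)

    -- The invariant of a walk from v: the current vertex u is joined to the last MixedAt vertex
    -- visited inside a single square of parity k.
    record Progress (c : Coloring) (col : Color) (v u : Vertex) : Set where
      constructor progress
      field
        {last}   : Vertex
        steps    : Star (SquareStep c col) v last
        mixed    : MixedAt c last
        position : last ≡ u ⊎ WithinSquare c col last u

    module Walk (c : Coloring) (col : Color) (two-two : TwoTwo c) where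

      close : ∀ {a u} → WithinSquare c col a u → MixedAt c a → MixedAt c u → SquareStep c col a u
      close (within S pS p q a≡ u≡ _ linked) mixed-a mixed-u =
        squareStep S pS p q a≡ u≡ (mixed-a S p pS a≡) (mixed-u S q pS u≡) linked

      depart : ∀ {v u u'} → Star (SquareStep c col) v u → MixedAt c u → Adj n c col u u' →
               Progress c col v u'
      depart steps mixed (e , inL , c≡col , joins) with hostOf n e inL
      ... | host S pS s refl with side-step col c S s inL c≡col joins
      ...   | q , r , u≡ , u'≡ , q~r = progress steps mixed (inj₂ (within S pS q r u≡ u'≡
                (joins⇒distinct col (patchOf c S) q r q~r) (joins⇒connected col (patchOf c S) q r q~r)))

      leaving⇒MixedAt : ∀ {a u u' e} (w : WithinSquare c col a u) → InL n e → c e ≡ col → Joins e u u' →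
                        (h : Host e) → Host.square h ≢ WithinSquare.square w → MixedAt c u
      leaving⇒MixedAt {u = u} {u'} {e} (within S pS p q _ refl p≢q linked) inL c≡col joins h apart =
        let (s , inL' , c≡col' , inc') =
              coloredAt⇒side col c S q (connected⇒coloredAt col (patchOf c S) p q p≢q linked)
            inc = Joins⇒Incident {e} {u} {u'} joins
            int = interior-of-two-edges inc' inc inL' inL (λ eq → apart (Host-unique h (host S pS s (sym eq))))
        in two-hosts⇒MixedAt col c u int (TwoTwo-count {c} two-two col u int) inc' inc c≡col' c≡col
             (host S pS s refl) h (apart ∘ sym)

      continue : ∀ {a u u'} (w : WithinSquare c col a u) → let S = WithinSquare.square w in
                 ∀ q r → u ≡ cornerOf S q → u' ≡ cornerOf S r → T (joinsᵇ col (patchOf c S) q r) →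
                 a ≡ u' ⊎ WithinSquare c col a u'
      continue {a} {u' = u'} (within S pS p q₀ a≡ refl _ linked) q r u≡ u'≡ q~r = extend-or-return (p ≟ᶜ r)
        where
        q₀~r : T (joinsᵇ col (patchOf c S) q₀ r)
        q₀~r = subst (λ q → T (joinsᵇ col (patchOf c S) q r)) (sym (cornerOf-injective S u≡)) q~r
        extend-or-return : Dec (p ≡ r) → a ≡ u' ⊎ WithinSquare c col a u'
        extend-or-return (yes p≡r) = inj₁ (trans a≡ (trans (cong (cornerOf S) p≡r) (sym u'≡)))
        extend-or-return (no p≢r)  =
          inj₂ (within S pS p r a≡ u'≡ p≢r (connected-extend col (patchOf c S) p q₀ r linked q₀~r))

      advance : ∀ {v u u'} → Progress c col v u → Adj n c col u u' → Progress c col v u'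
      advance (progress steps mixed (inj₁ refl)) adj = depart steps mixed adj
      advance (progress steps mixed (inj₂ w)) adj@(e , inL , c≡col , joins) with hostOf n e inL
      ... | h@(host S pS s refl) with S ≟ˢ WithinSquare.square w
      ...   | no apart = depart (steps ◅◅ close w mixed mixed-u ◅ ε) mixed-u adj
        where
        mixed-u = leaving⇒MixedAt w inL c≡col joins h apart
      ...   | yes refl with side-step col c S s inL c≡col joins
      ...     | q , r , u≡ , u'≡ , q~r = progress steps mixed (continue w q r u≡ u'≡ q~r)

      walk : ∀ {v u w} → Progress c col v u → SameComponent n c col u w → Progress c col v w
      walk prog ε            = prog
      walk prog (adj ◅ path) = walk (advance prog adj) path

      square-steps : ∀ {v w} → MixedAt c v → MixedAt c w → SameComponent n c col v w →
                     Star (SquareStep c col) v w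
      square-steps mixed-v mixed-w path with walk (progress ε mixed-v (inj₁ refl)) path
      ... | progress steps _     (inj₁ refl) = steps
      ... | progress steps mixed (inj₂ w)    = steps ◅◅ close w mixed mixed-w ◅ ε

    SquareStep⇒SameComponent : ∀ {c col a b} → SquareStep c col a b → SameComponent n c col a b
    SquareStep⇒SameComponent {c} {col} (squareStep S _ p q refl refl _ _ linked) =
      connected⇒SameComponent col c S p q linked

    SquareSteps⇒SameComponent : ∀ {c col a b} → Star (SquareStep c col) a b → SameComponent n c col a b
    SquareSteps⇒SameComponent ε            = ε
    SquareSteps⇒SameComponent (st ◅ steps) = SquareStep⇒SameComponent st ◅◅ SquareSteps⇒SameComponent steps

    record Toggled (c c' : Coloring) : Set where
      constructor toggled
      field patch-toggled : ∀ S → Par S → patchOf c' S ≡ toggle (patchOf c S)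
    open Toggled

    Compatible : Coloring → Set
    Compatible c = ∀ S → Par S → T (compatibleᵇ (patchOf c S))

    Toggled-sym : ∀ {c c'} → Toggled c c' → Toggled c' c
    Toggled-sym {c} tog = toggled λ S pS →
      trans (sym (toggle-involutive (patchOf c S))) (cong toggle (sym (patch-toggled tog S pS)))

    Toggled-Compatible : ∀ {c c'} → Toggled c c' → Compatible c → Compatible c'
    Toggled-Compatible {c} tog compat S pS = subst (T ∘ compatibleᵇ) (sym (patch-toggled tog S pS))
      (toggle-preserves-compatible (patchOf c S) (compat S pS))

    Toggled-MixedAt : ∀ {c c' u} → Toggled c c' → MixedAt c u → MixedAt c' u
    Toggled-MixedAt {c} tog mixed S p pS u≡ = subst (λ P → T (mixedᵇ P p)) (sym (patch-toggled tog S pS))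
      (toggle-preserves-mixed (patchOf c S) p (mixed S p pS u≡))

    Toggled-SquareStep : ∀ {c c' col a b} → Toggled c c' → Compatible c →
                         SquareStep c col a b → SquareStep c' col a b
    Toggled-SquareStep {c} {col = col} tog compat (squareStep S pS p q a≡ b≡ mp mq linked) =
      squareStep S pS p q a≡ b≡
        (subst (λ P → T (mixedᵇ P p)) (sym (patch-toggled tog S pS)) (toggle-preserves-mixed P p mp))
        (subst (λ P → T (mixedᵇ P q)) (sym (patch-toggled tog S pS)) (toggle-preserves-mixed P q mq))
        (subst (λ P → T (connectedᵇ col P p q)) (sym (patch-toggled tog S pS))
               (toggle-preserves-connected col P p q mp mq (compat S pS) linked))
      where
      P = patchOf c S

    Toggled-SameComponent : ∀ {c c' col v w} → Toggled c c' → Compatible c → TwoTwo c →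
                            MixedAt c v → MixedAt c w → SameComponent n c col v w → SameComponent n c' col v w
    Toggled-SameComponent {c} {col = col} tog compat two-two mixed-v mixed-w path =
      SquareSteps⇒SameComponent
        (Star.map (Toggled-SquareStep tog compat) (Walk.square-steps c col two-two mixed-v mixed-w path))

    Toggled-edge : ∀ {c c'} → Toggled c c' → ∀ S s → Par S → InL n (edgeOf S s) →
                   c' (edgeOf S s) ≡ flipUnless (alternatingᵇ (patchOf c S)) (c (edgeOf S s))
    Toggled-edge {c} {c'} tog S s pS inL = just-injective (begin
      just (c' (edgeOf S s))                      ≡⟨ colorIn-InL c' S s inL ⟨
      colorIn c' S s                              ≡⟨ colorOn-patchOf c' S s ⟨
      colorOn (patchOf c' S) s                    ≡⟨ cong (λ P → colorOn P s) (patch-toggled tog S pS) ⟩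
      colorOn (toggle (patchOf c S)) s            ≡⟨ colorOn-toggle (patchOf c S) s ⟩
      flipᵐ (colorOn (patchOf c S) s)             ≡⟨ cong flipᵐ (colorOn-patchOf c S s) ⟩
      flipᵐ (colorIn c S s)                       ≡⟨ cong flipᵐ (colorIn-InL c S s inL) ⟩
      just (flipUnless alt (c (edgeOf S s)))      ∎)
      where
      open ≡-Reasoning
      alt = alternatingᵇ (patchOf c S)
      flipᵐ = Maybe.map (flipUnless alt)

    alternating⇒sides-differ : ∀ c S p → T (alternatingᵇ (patchOf c S)) →
                               T (not (c (edgeOf S (horizontalAt p)) ==C c (edgeOf S (verticalAt p))))
    alternating⇒sides-differ c S p = ≢⇒not-==C ∘ mixed-patchOf⁻ c S p ∘ alternating⇒mixed (patchOf c S) p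

    alternating⇒mixedPair : ∀ c x y δ g → T (alternatingᵇ (patchOf c (squareAt (suc x , suc y) δ g))) →
                            T (mixedPairᵇ δ (c ∘ edgeTowards (suc x , suc y)) g)
    alternating⇒mixedPair c x y rising  true  = alternating⇒sides-differ c (suc x , suc y) (false , false)
    alternating⇒mixedPair c x y rising  false = alternating⇒sides-differ c (x , y)         (true , true)
    alternating⇒mixedPair c x y falling true  = alternating⇒sides-differ c (x , suc y)     (true , false)
    alternating⇒mixedPair c x y falling false = alternating⇒sides-differ c (suc x , y)     (false , true)

    Toggled-TwoTwo : ∀ {c c'} → Toggled c c' → TwoTwo c → TwoTwo c'
    Toggled-TwoTwo {c} {c'} tog two-two (suc x , suc y) int =
      count-of blue (proj₁ halves) , count-of green (proj₂ halves)
      where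
      u = suc x , suc y
      δ = proj₁ (diagonalAt u)
      keep : Bool → Bool
      keep g = alternatingᵇ (patchOf c (squareAt u δ g))
      recolored : Direction → Color
      recolored d = flipUnless (keep (inNorthern δ d)) (c (edgeTowards u d))
      c'-at : ∀ d → c' (edgeTowards u d) ≡ recolored d
      c'-at d with ∈sqEdges⇒side _ (edgeTowards∈squareAt x y δ d)
      ... | s , eq rewrite eq = Toggled-edge {c} {c'} tog _ s (squareAt-Par x y δ (proj₂ (diagonalAt u)) _)
                                  (subst (InL n) eq (edgeTowards-InL int d))
      twoTwo-c : T (twoTwoᵇ (c ∘ edgeTowards u))
      twoTwo-c = Equivalence.from T-∧
        ( ≡⇒≡ᵇ _ 2 (trans (sym (count≡colorCount c blue (edgesAt u))) (proj₁ (two-two u int)))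
        , ≡⇒≡ᵇ _ 2 (trans (sym (count≡colorCount c green (edgesAt u))) (proj₂ (two-two u int))))
      halves = Equivalence.to (T-∧ {colorCount blue (around recolored) ≡ᵇ 2})
        (recolor-pairs-twoTwo δ (c ∘ edgeTowards u) keep twoTwo-c
          (alternating⇒mixedPair c x y δ true) (alternating⇒mixedPair c x y δ false))
      count-of : ∀ col → T (colorCount col (around recolored) ≡ᵇ 2) → count c' col (edgesAt u) ≡ 2
      count-of col h = trans (count≡colorCount c' col (edgesAt u))
                             (trans (cong (colorCount col) (around-cong c'-at)) (≡ᵇ⇒≡ _ 2 h))

    Toggled-SameComponent⇔ : ∀ {c c' col v w} → Toggled c c' → Compatible c → TwoTwo c →
                             MixedAt c v → MixedAt c w → SameComponent n c' col v w ⇔ SameComponent n c col v w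
    Toggled-SameComponent⇔ tog compat two-two mixed-v mixed-w = mk⇔
      (Toggled-SameComponent (Toggled-sym tog) (Toggled-Compatible tog compat) (Toggled-TwoTwo tog two-two)
         (Toggled-MixedAt tog mixed-v) (Toggled-MixedAt tog mixed-w))
      (Toggled-SameComponent tog compat two-two mixed-v mixed-w)

    selected : ℕ → ℕ → Bool
    selected i j = ((i + j) % 2 ≡ᵇ toℕ k) ∧ sharesEdgeᵇ n (i , j)

    cell : ℕ → ℕ → List Square
    cell i j = if selected i j then [ (i , j) ] else []

    row : ℕ → List Square
    row i = concatMap (cell i) (upTo (suc n))

    ∈-cell : ∀ {i j S} → S ∈ cell i j → S ≡ (i , j) × T (selected i j)
    ∈-cell {i} {j} S∈ with selected i j
    ∈-cell (here refl) | true = refl , tt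

    cell-Unique : ∀ i j → Unique (cell i j)
    cell-Unique i j with selected i j
    ... | true  = [] ∷ []
    ... | false = []

    ∈-row⇒∈-cell : ∀ {i S} → S ∈ row i → ∃ λ j → S ∈ cell i j
    ∈-row⇒∈-cell {i} S∈ =
      let (j , _ , S∈cell) = find (∈-concatMap⁻ (cell i) {xs = upTo (suc n)} S∈) in j , S∈cell

    squaresOf-Unique : Unique (squaresOf n k)
    squaresOf-Unique = concatMap-Unique row proj₁ (upTo⁺ (suc n))
      (λ i → concatMap-Unique (cell i) proj₂ (upTo⁺ (suc n)) (cell-Unique i)
               (λ j → cong proj₂ ∘ proj₁ ∘ ∈-cell))
      (λ i → cong proj₁ ∘ proj₁ ∘ ∈-cell ∘ proj₂ ∘ ∈-row⇒∈-cell)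

    squaresOf-Par : ∀ {S} → S ∈ squaresOf n k → Par S
    squaresOf-Par S∈ with find (∈-concatMap⁻ row {xs = upTo (suc n)} S∈)
    ... | i , _ , S∈row with ∈-row⇒∈-cell S∈row
    ...   | j , S∈cell with ∈-cell S∈cell
    ...     | refl , sel = ≡ᵇ⇒≡ _ _ (proj₁ (Equivalence.to T-∧ sel))

    squaresOf-∋ : ∀ i j → i ≤ n → j ≤ n → Par (i , j) → T (sharesEdgeᵇ n (i , j)) →
                  (i , j) ∈ squaresOf n k
    squaresOf-∋ i j i≤n j≤n p shares =
      ∈-concatMap⁺ row {xs = upTo (suc n)} (lose (∈-upTo⁺ (s≤s i≤n))
        (∈-concatMap⁺ (cell i) {xs = upTo (suc n)} (lose (∈-upTo⁺ (s≤s j≤n)) ∈cell)))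
      where
      ∈cell : (i , j) ∈ cell i j
      ∈cell rewrite Equivalence.to T-≡ (Equivalence.from T-∧ (≡⇒≡ᵇ _ _ p , shares)) = here refl

    side-bounds : ∀ S s → InL n (edgeOf S s) → proj₁ S ≤ n × proj₂ S ≤ n
    side-bounds S bottom (i≤n , _ , j≤n)   = i≤n , j≤n
    side-bounds S top    (i≤n , _ , j<n)   = i≤n , <⇒≤ j<n
    side-bounds S left   ((_ , i≤n) , j≤n) = i≤n , j≤n
    side-bounds S right  ((_ , i<n) , j≤n) = <⇒≤ i<n , j≤n

    side∈squaresOf : ∀ S s → Par S → InL n (edgeOf S s) → S ∈ squaresOf n k
    side∈squaresOf S@(i , j) s p inL =
      squaresOf-∋ i j (proj₁ (side-bounds S s inL)) (proj₂ (side-bounds S s inL)) p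
        (any⁺ (inLᵇ n) (lose (edgeOf∈sqEdges S s) (Equivalence.from (inLᵇ⇔InL (edgeOf S s)) inL)))

    H-sq-outside : ∀ U c e → ¬ e ∈ sqEdges U → H-sq n U c e ≡ c e
    H-sq-outside U c e e∉U with e ∈ᵇ sqEdges U in e∈ᵇU
    ... | true  = ⊥-elim (e∉U (Equivalence.to (∈ᵇ⇔∈ e (sqEdges U)) (subst T (sym e∈ᵇU) tt)))
    ... | false = refl

    alternating≡alternatingᵇ : ∀ c S → alternating n c S ≡ alternatingᵇ (patchOf c S)
    alternating≡alternatingᵇ c (i , j)
      with inLᵇ n (hor i j) | inLᵇ n (hor i (suc j)) | inLᵇ n (ver i j) | inLᵇ n (ver (suc i) j)
    ... | false | _     | _     | _     = refl
    ... | true  | false | _     | _     = refl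
    ... | true  | true  | false | _     = refl
    ... | true  | true  | true  | false = refl
    ... | true  | true  | true  | true  = refl

    H-sq-side : ∀ S c s → InL n (edgeOf S s) →
                H-sq n S c (edgeOf S s) ≡ flipUnless (alternatingᵇ (patchOf c S)) (c (edgeOf S s))
    H-sq-side S c s inL
      rewrite Equivalence.to T-≡ (Equivalence.from (∈ᵇ⇔∈ (edgeOf S s) (sqEdges S)) (edgeOf∈sqEdges S s))
            | Equivalence.to T-≡ (Equivalence.from (inLᵇ⇔InL (edgeOf S s)) inL)
            | alternating≡alternatingᵇ c S
      with alternatingᵇ (patchOf c S)
    ... | true  = refl
    ... | false = refl

    foldr-H-sq-outside : ∀ c S s L → Par S → All Par L → All (S ≢_) L →
                         foldr (H-sq n) c L (edgeOf S s) ≡ c (edgeOf S s)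
    foldr-H-sq-outside c S s []      pS []          []            = refl
    foldr-H-sq-outside c S s (U ∷ L) pS (pU ∷ pars) (S≢U ∷ apart) =
      trans (H-sq-outside U (foldr (H-sq n) c L) (edgeOf S s)
              λ e∈U → S≢U (square-unique S U (edgeOf∈sqEdges S s) e∈U pS pU))
            (foldr-H-sq-outside c S s L pS pars apart)

    foldr-H-sq-inside : ∀ c S s L → Par S → All Par L → Unique L → S ∈ L → InL n (edgeOf S s) →
                        foldr (H-sq n) c L (edgeOf S s) ≡ flipUnless (alternatingᵇ (patchOf c S)) (c (edgeOf S s))
    foldr-H-sq-inside c S s (S ∷ L) pS (_ ∷ pars) (S∉L ∷ _) (here refl) inL = begin
      H-sq n S c' (edgeOf S s)                                    ≡⟨ H-sq-side S c' s inL ⟩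
      flipUnless (alternatingᵇ (patchOf c' S)) (c' (edgeOf S s))
        ≡⟨ cong₂ (λ P x → flipUnless (alternatingᵇ P) x) (patchOf-cong {c} {c'} S untouched) (untouched s) ⟩
      flipUnless (alternatingᵇ (patchOf c S)) (c (edgeOf S s))    ∎
      where
      open ≡-Reasoning
      c' = foldr (H-sq n) c L
      untouched : ∀ s' → c' (edgeOf S s') ≡ c (edgeOf S s')
      untouched s' = foldr-H-sq-outside c S s' L pS pars S∉L
    foldr-H-sq-inside c S s (U ∷ L) pS (pU ∷ pars) (U∉L ∷ uniq) (there S∈L) inL =
      trans (H-sq-outside U (foldr (H-sq n) c L) (edgeOf S s)
              λ e∈U → All.lookup U∉L S∈L (square-unique U S e∈U (edgeOf∈sqEdges S s) pU pS))
            (foldr-H-sq-inside c S s L pS pars uniq S∈L inL)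

    colorIn-H : ∀ c S → Par S → ∀ s →
                colorIn (H n k c) S s ≡ Maybe.map (flipUnless (alternatingᵇ (patchOf c S))) (colorIn c S s)
    colorIn-H c S pS s with inLᵇ n (edgeOf S s) in inLᵇ≡
    ... | false = refl
    ... | true  = cong just (foldr-H-sq-inside c S s (squaresOf n k) pS (All.tabulate squaresOf-Par)
                               squaresOf-Unique (side∈squaresOf S s pS inL) inL)
      where
      inL = Equivalence.to (inLᵇ⇔InL (edgeOf S s)) (subst T (sym inLᵇ≡) tt)

    H-Toggled : ∀ c → Toggled c (H n k c)
    H-Toggled c = toggled toggled-at
      where
      toggled-at : ∀ S → Par S → patchOf (H n k c) S ≡ toggle (patchOf c S)
      toggled-at S pS = patch-ext λ s → begin
        colorOn (patchOf (H n k c) S) s    ≡⟨ colorOn-patchOf (H n k c) S s ⟩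
        colorIn (H n k c) S s              ≡⟨ colorIn-H c S pS s ⟩
        flipᵐ (colorIn c S s)              ≡⟨ cong flipᵐ (colorOn-patchOf c S s) ⟨
        flipᵐ (colorOn (patchOf c S) s)    ≡⟨ colorOn-toggle (patchOf c S) s ⟨
        colorOn (toggle (patchOf c S)) s   ∎
        where
        open ≡-Reasoning
        flipᵐ = Maybe.map (flipUnless (alternatingᵇ (patchOf c S)))

    pair-compatible : ∀ c S s s' a a' →
      (InL n (edgeOf S s) → InL n (edgeOf S s') → ¬ (InL n (edgeOf S a) × InL n (edgeOf S a')) →
       c (edgeOf S s) ≢ c (edgeOf S s')) →
      T (present (colorIn c S s) ∧ present (colorIn c S s')
         ∧ not (present (colorIn c S a) ∧ present (colorIn c S a'))) →
      T (differentColors (colorIn c S s) (colorIn c S s'))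
    pair-compatible c S s s' a a' differs h
      with Equivalence.to (T-∧ {present (colorIn c S s)}) h
    ... | ps , h' with Equivalence.to (T-∧ {present (colorIn c S s')}) h'
    ...   | ps' , not-both = differentColors-colorIn c S s s' (to-InL s ps) (to-InL s' ps')
              (differs (to-InL s ps) (to-InL s' ps')
                 λ (ia , ia') → T-not not-both (Equivalence.from T-∧ (of-InL a ia , of-InL a' ia')))
      where
      to-InL : ∀ s → T (present (colorIn c S s)) → InL n (edgeOf S s)
      to-InL s = Equivalence.to (inLᵇ⇔InL (edgeOf S s)) ∘ subst T (present-colorIn c S s)
      of-InL : ∀ s → InL n (edgeOf S s) → T (present (colorIn c S s))
      of-InL s = subst T (sym (present-colorIn c S s)) ∘ Equivalence.from (inLᵇ⇔InL (edgeOf S s))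

    horizontal-pair-differs : ∀ {c} → InA n c → ∀ i j → InL n (hor i j) → InL n (hor i (suc j)) →
                              ¬ (InL n (ver i j) × InL n (ver (suc i) j)) → c (hor i j) ≢ c (hor i (suc j))
    horizontal-pair-differs (_ , west-east , _) zero j (_ , 1≤j , j≤n) (_ , _ , sj≤n) _ =
      alternate-colors j (suc j) (Fin.suc Fin.zero) refl
        (proj₁ (west-east j 1≤j j≤n)) (proj₁ (west-east (suc j) (s≤s z≤n) sj≤n))
    horizontal-pair-differs {c} (_ , west-east , _) (suc i) j (si≤n , 1≤j , j≤n) (_ , _ , sj≤n) not-both
      with suc (suc i) ≤? n
    ... | yes ssi≤n = ⊥-elim (not-both (((s≤s z≤n , si≤n) , j≤n) , ((s≤s z≤n , ssi≤n) , j≤n)))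
    ... | no  ssi≰n = subst (λ m → c (hor m j) ≢ c (hor m (suc j))) (sym (≤-last si≤n ssi≰n))
      (alternate-colors (suc n + j) (suc n + suc j) (Fin.suc Fin.zero) (cong (λ m → suc m % 2) (+-suc n j))
         (proj₂ (west-east j 1≤j j≤n)) (proj₂ (west-east (suc j) (s≤s z≤n) sj≤n)))

    vertical-pair-differs : ∀ {c} → InA n c → ∀ i j → InL n (ver i j) → InL n (ver (suc i) j) →
                            ¬ (InL n (hor i j) × InL n (hor i (suc j))) → c (ver i j) ≢ c (ver (suc i) j)
    vertical-pair-differs (_ , _ , south-north) i zero ((1≤i , i≤n) , _) ((_ , si≤n) , _) _ =
      alternate-colors (i + 0) (suc i + 0) Fin.zero refl
        (proj₁ (south-north i 1≤i i≤n)) (proj₁ (south-north (suc i) (s≤s z≤n) si≤n))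
    vertical-pair-differs {c} (_ , _ , south-north) i (suc j) ((1≤i , i≤n) , sj≤n) ((_ , si≤n) , _) not-both
      with suc (suc j) ≤? n
    ... | yes ssj≤n = ⊥-elim (not-both ((i≤n , s≤s z≤n , sj≤n) , (i≤n , s≤s z≤n , ssj≤n)))
    ... | no  ssj≰n = subst (λ m → c (ver i m) ≢ c (ver (suc i) m)) (sym (≤-last sj≤n ssj≰n))
      (alternate-colors (i + suc n) (suc i + suc n) Fin.zero refl
         (proj₂ (south-north i 1≤i i≤n)) (proj₂ (south-north (suc i) (s≤s z≤n) si≤n)))

    InA⇒Compatible : ∀ {c} → InA n c → Compatible c
    InA⇒Compatible {c} inA S@(i , j) _ = Equivalence.from (T-∧ {horizontal}) (⇒ᵇ-intro h-pair , ⇒ᵇ-intro v-pair)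
      where
      horizontal = present (colorIn c S bottom) ∧ present (colorIn c S top)
                   ∧ not (present (colorIn c S left) ∧ present (colorIn c S right))
                   ⇒ᵇ differentColors (colorIn c S bottom) (colorIn c S top)
      h-pair = pair-compatible c S bottom top left right (horizontal-pair-differs {c} inA i j)
      v-pair = pair-compatible c S left right bottom top (vertical-pair-differs {c} inA i j)

mainTheorem2 : (n : ℕ) → 1 ≤ n → (c : Coloring) → InA n c → (k : Fin 2) →
    (v w : Vertex) → Interior n v → Interior n w →
    Fixed n c k v → Fixed n c k w →
    (SameComponent n (H n k c) blue v w ⇔ SameComponent n c blue v w)
    × (SameComponent n (H n k c) green v w ⇔ SameComponent n c green v w)
mainTheorem2 n _ c inA k v w int-v int-w fixed-v fixed-w = components blue , components green
  where
  two-two = proj₁ inA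
  components : ∀ col → SameComponent n (H n k c) col v w ⇔ SameComponent n c col v w
  components col = Toggled-SameComponent⇔ k n (H-Toggled k n c) (InA⇒Compatible k n {c} inA) two-two
    (Fixed⇒MixedAt k n {c} two-two int-v fixed-v) (Fixed⇒MixedAt k n {c} two-two int-w fixed-w)
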